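{- Suppose $\Delta, m, s \in \mathbb{N}$. Let $G$ be a graph, let $A\subseteq V(G)$, and let $u_1,\dots, u_m$ be a sequence of (not necessarily distinct) vertices of $G$. Let $W_1,\dots, W_m$ be sets of vertices and let $H$ be a graph on $[m]$ such that (i) $d_{G,A}(u_i)-|W_i|\geq 3\Delta + m/s+s$ for all $i\in [m]$; (ii) $|\{i\in [m]: v=u_i\}| \leq \Delta$ for every $v\in V(G)$; (iii) $\Delta(H)\leq \Delta$. Then we can choose distinct edges $u_1v_1,\dots, u_mv_m$ of $G$ such that $|\{i\in [m]: v=v_i\}|\leq s$ for all $v\in V(G)$, $v_i\in A\setminus W_i$ for all $i\in [m]$, and $v_i\notin \{u_j, v_{j}\}$ whenever $ij\in E(H)$.
   Context: $d_{G,A}(u)$ denotes the number of neighbours of $u$ in $G$ that lie in $A$; $\Delta(H)$ is the maximum degree of $H$. -}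

module Defs where

open import Data.Nat using (ℕ; zero; suc; _+_; _≤_)
open import Data.Bool using (Bool; true; false; _∧_; if_then_else_)
open import Data.Fin using (Fin; zero; suc)
open import Data.Fin.Subset using (Subset; _∈_)
open import Data.Fin.Subset.Properties using (_∈?_)
open import Relation.Nullary using (does)
open import Relation.Binary.PropositionalEquality using (_≡_)

record Graph (n : ℕ) : Set where
  field
    adj    : Fin n → Fin n → Bool
    sym    : ∀ u v → adj u v ≡ adj v u
    irrefl : ∀ v → adj v v ≡ false
open Graph public

count : ∀ {n} → (Fin n → Bool) → ℕ
count {zero}  p = 0
count {suc n} p = (if p zero then 1 else 0) + count (λ x → p (suc x))

degIn : ∀ {n} → Graph n → Subset n → Fin n → ℕ
degIn G A u = count (λ v → adj G u v ∧ does (v ∈? A))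

maxDeg≤ : ∀ {m} → Graph m → ℕ → Set
maxDeg≤ {m} H Δ = ∀ i → count (adj H i) ≤ Δ

-- Greedy choice of v₁, …, vₘ in order. When vᵢ is chosen, a neighbour x ∈ A of uᵢ is ruled out only
-- if x ∈ Wᵢ; x = uₗ or x = vₗ for an H-neighbour l of i (at most 2Δ vertices by (iii)); the edge uᵢx
-- was already chosen as some uₗvₗ (at most Δ by (ii)) or as some vₗuₗ (at most s, the load of uᵢ); or x
-- already carries load s. The loads sum to fewer than m, so fewer than m/s vertices are full, and (i)
-- leaves a vertex that is not ruled out.
module Submission where

open import Defs
open import Data.Nat using (ℕ; _+_; _*_; _≤_)
open import Data.Bool using (true)
open import Data.Fin using (Fin; _≟_)
open import Data.Fin.Subset using (Subset; _∈_; _∉_; ∣_∣)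
open import Data.Product using (Σ; _×_)
open import Data.Sum using (_⊎_)
open import Relation.Nullary using (¬_; does)
open import Relation.Binary.PropositionalEquality using (_≡_; _≢_)

open import Data.Nat using (zero; suc; _<_; _<?_; _≤?_; z≤n; s≤s)
open import Data.Nat.Properties
  using ( ≤-refl; ≤-trans; ≤-reflexive; ≤-pred; m≤n⇒m≤1+n; n≤1+n; m≤n⇒m<n∨m≡n
        ; +-suc; +-mono-≤; +-monoʳ-≤; +-monoʳ-<; +-comm; +-*-semiring; *-identityˡ; *-identityʳ; *-zeroʳ
        ; *-distribˡ-+; *-cancelˡ-<; *-monoʳ-≤; <-irrefl; <⇒≤; ≰⇒>; module ≤-Reasoning)
open import Data.Nat.Tactic.RingSolver using (solve-∀)
open import Algebra.Properties.Semiring.Sum +-*-semiring using (sum; ∑-comm; *-distribˡ-sum; sum-cong-≗)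
open import Data.Bool using (Bool; false; _∧_; _∨_; if_then_else_)
open import Data.Bool.Properties using (∧-conicalˡ; ∧-conicalʳ; ∨-conicalˡ; ∨-conicalʳ; ∨-zeroʳ)
open import Data.Fin using (zero; suc; toℕ; fromℕ<)
open import Data.Fin.Properties using (toℕ-injective; toℕ-fromℕ<; toℕ<n; suc-injective)
open import Data.Fin.Subset using (inside; outside)
open import Data.Fin.Subset.Properties using (_∈?_)
open import Data.Vec using ([]; _∷_)
open import Data.Vec.Functional using (updateAt)
open import Data.Vec.Functional.Properties using (updateAt-updates; updateAt-minimal)
open import Data.Product using (_,_) renaming (map to map-Σ)
open import Data.Sum using (inj₁; inj₂)
open import Function using (_∘_; id; const)
open import Relation.Nullary using (Dec; yes; no; contradiction)
open import Relation.Nullary.Decidable using (dec-true; dec-false)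
open import Relation.Binary.PropositionalEquality as ≡ using (refl; trans; cong; cong₂)

does-true : ∀ {p} {P : Set p} (P? : Dec P) → does P? ≡ true → P
does-true (yes p) _ = p

does-false : ∀ {p} {P : Set p} (P? : Dec P) → does P? ≡ false → ¬ P
does-false (no ¬p) _ = ¬p

indicator : Bool → ℕ
indicator b = if b then 1 else 0

∨-false : ∀ a {b} → a ∨ b ≡ false → a ≡ false × b ≡ false
∨-false a {b} e = ∨-conicalˡ a b e , ∨-conicalʳ a b e

count-mono : ∀ {n} {p q : Fin n → Bool} → (∀ x → p x ≡ true → q x ≡ true) → count p ≤ count q
count-mono {zero}  p⊆q = z≤n
count-mono {suc n} {p} {q} p⊆q with p zero in p₀ | q zero in q₀
... | true  | true  = s≤s (count-mono (p⊆q ∘ suc))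
... | true  | false = contradiction (trans (≡.sym (p⊆q zero p₀)) q₀) λ ()
... | false | true  = m≤n⇒m≤1+n (count-mono (p⊆q ∘ suc))
... | false | false = count-mono (p⊆q ∘ suc)

count-∨ : ∀ {n} (p q : Fin n → Bool) → count (λ x → p x ∨ q x) ≤ count p + count q
count-∨ {zero}  p q = z≤n
count-∨ {suc n} p q with p zero | q zero
... | true  | true  = s≤s (≤-trans (count-∨ (p ∘ suc) (q ∘ suc)) (+-monoʳ-≤ (count (p ∘ suc)) (n≤1+n _)))
... | true  | false = s≤s (count-∨ (p ∘ suc) (q ∘ suc))
... | false | true  = ≤-trans (s≤s (count-∨ (p ∘ suc) (q ∘ suc))) (≤-reflexive (≡.sym (+-suc (count (p ∘ suc)) _)))
... | false | false = count-∨ (p ∘ suc) (q ∘ suc)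

count-∨-≤ : ∀ {n} (p q : Fin n → Bool) {a b} → count p ≤ a → count q ≤ b → count (λ x → p x ∨ q x) ≤ a + b
count-∨-≤ p q p≤a q≤b = ≤-trans (count-∨ p q) (+-mono-≤ p≤a q≤b)

count-⊎ : ∀ {n} {p q r : Fin n → Bool} → (∀ x → p x ≡ true → q x ≡ true ⊎ r x ≡ true) →
  count p ≤ count q + count r
count-⊎ {q = q} {r} p⊆q∪r = ≤-trans (count-mono (λ x pₓ → join (p⊆q∪r x pₓ))) (count-∨ q r)
  where
  join : ∀ {a b} → a ≡ true ⊎ b ≡ true → a ∨ b ≡ true
  join {b = b} (inj₁ refl) = refl
  join {a = a} (inj₂ refl) = ∨-zeroʳ a

count-false : ∀ {n} (p : Fin n → Bool) → (∀ x → p x ≡ false) → count p ≡ 0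
count-false {zero}  p p≡false = refl
count-false {suc n} p p≡false rewrite p≡false zero = count-false (p ∘ suc) (p≡false ∘ suc)

count-≤1 : ∀ {n} (p : Fin n → Bool) → (∀ x y → p x ≡ true → p y ≡ true → x ≡ y) → count p ≤ 1
count-≤1 {zero}  p unique = z≤n
count-≤1 {suc n} p unique with p zero in p₀
... | true  = ≤-reflexive (cong suc (count-false (p ∘ suc) others))
  where
  others : ∀ x → p (suc x) ≡ false
  others x with p (suc x) in pₓ
  ... | true  = contradiction (unique (suc x) zero pₓ p₀) λ ()
  ... | false = refl
... | false = count-≤1 (p ∘ suc) (λ x y pₓ p_y → suc-injective (unique (suc x) (suc y) pₓ p_y))

count-pos : ∀ {n} (p : Fin n → Bool) {x} → p x ≡ true → 1 ≤ count p
count-pos p {zero}  pₓ rewrite pₓ = s≤s z≤n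
count-pos p {suc x} pₓ with p zero
... | true  = s≤s z≤n
... | false = count-pos (p ∘ suc) pₓ

count≤n : ∀ {n} (p : Fin n → Bool) → count p ≤ n
count≤n {zero}  p = z≤n
count≤n {suc n} p with p zero
... | true  = s≤s (count≤n (p ∘ suc))
... | false = m≤n⇒m≤1+n (count≤n (p ∘ suc))

count<n : ∀ {n} (p : Fin n → Bool) {x} → p x ≡ false → count p < n
count<n p {zero}  pₓ rewrite pₓ = s≤s (count≤n (p ∘ suc))
count<n p {suc x} pₓ with p zero
... | true  = s≤s (count<n (p ∘ suc) pₓ)
... | false = m≤n⇒m≤1+n (count<n (p ∘ suc) pₓ)

count-<-witness : ∀ {n} (p q : Fin n → Bool) → count q < count p → Σ (Fin n) λ x → p x ≡ true × q x ≡ false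
count-<-witness {suc n} p q q<p with p zero in p₀ | q zero in q₀
... | true  | false = zero , p₀ , q₀
... | true  | true  = map-Σ suc id (count-<-witness (p ∘ suc) (q ∘ suc) (≤-pred q<p))
... | false | true  = map-Σ suc id (count-<-witness (p ∘ suc) (q ∘ suc) (≤-trans (n≤1+n _) q<p))
... | false | false = map-Σ suc id (count-<-witness (p ∘ suc) (q ∘ suc) q<p)

count-∈ : ∀ {n} (X : Subset n) → count (λ x → does (x ∈? X)) ≡ ∣ X ∣
count-∈ []            = refl
count-∈ (inside  ∷ X) = cong suc (count-∈ X)
count-∈ (outside ∷ X) = count-∈ X

count≡sum : ∀ {n} (p : Fin n → Bool) → count p ≡ sum (indicator ∘ p)
count≡sum {zero}  p = refl
count≡sum {suc n} p = cong (indicator (p zero) +_) (count≡sum (p ∘ suc))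

sum-mono-≤ : ∀ {n} {f g : Fin n → ℕ} → (∀ x → f x ≤ g x) → sum f ≤ sum g
sum-mono-≤ {zero}  f≤g = z≤n
sum-mono-≤ {suc n} f≤g = +-mono-≤ (f≤g zero) (sum-mono-≤ (f≤g ∘ suc))

markov : ∀ {n} (s : ℕ) (f : Fin n → ℕ) → s * count (λ y → does (s ≤? f y)) ≤ sum f
markov s f = begin
  s * count large                     ≡⟨ cong (s *_) (count≡sum large) ⟩
  s * sum (indicator ∘ large)         ≡⟨ *-distribˡ-sum s (indicator ∘ large) ⟩
  sum (λ y → s * indicator (large y)) ≤⟨ sum-mono-≤ bounded ⟩
  sum f                               ∎
  where
  open ≤-Reasoning
  large = λ y → does (s ≤? f y)
  bounded : ∀ y → s * indicator (large y) ≤ f y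
  bounded y with large y in s≤?f
  ... | true  = ≤-trans (≤-reflexive (*-identityʳ s)) (does-true (s ≤? f y) s≤?f)
  ... | false = ≤-trans (≤-reflexive (*-zeroʳ s)) z≤n

fibre : ∀ {m n} → (Fin m → Bool) → (Fin m → Fin n) → Fin n → ℕ
fibre q g y = count (λ j → q j ∧ does (g j ≟ y))

sum-fibre≤count : ∀ {m n} (q : Fin m → Bool) (g : Fin m → Fin n) → sum (fibre q g) ≤ count q
sum-fibre≤count {m} {n} q g = begin
  sum (fibre q g)                            ≡⟨ sum-cong-≗ (λ y → count≡sum (λ j → hit j y)) ⟩
  sum (λ y → sum (λ j → indicator (hit j y))) ≡⟨ ∑-comm (λ y j → indicator (hit j y)) ⟩
  sum (λ j → sum (λ y → indicator (hit j y))) ≡⟨ sum-cong-≗ (λ j → ≡.sym (count≡sum (hit j))) ⟩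
  sum (λ j → count (hit j))                  ≤⟨ sum-mono-≤ single ⟩
  sum (indicator ∘ q)                        ≡⟨ ≡.sym (count≡sum q) ⟩
  count q                                    ∎
  where
  open ≤-Reasoning
  hit : Fin m → Fin n → Bool
  hit j y = q j ∧ does (g j ≟ y)
  single : ∀ j → count (hit j) ≤ indicator (q j)
  single j with q j
  ... | true  = count-≤1 _ λ x y gx gy → trans (≡.sym (does-true (g j ≟ x) gx)) (does-true (g j ≟ y) gy)
  ... | false = ≤-reflexive (count-false (λ y → false ∧ does (g j ≟ y)) λ _ → refl)

image : ∀ {m n} → (Fin m → Bool) → (Fin m → Fin n) → Fin n → Bool
image q g y = does (1 ≤? fibre q g y)

count-image≤count : ∀ {m n} (q : Fin m → Bool) (g : Fin m → Fin n) → count (image q g) ≤ count q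
count-image≤count q g = ≤-trans (≤-reflexive (≡.sym (*-identityˡ _)))
  (≤-trans (markov 1 (fibre q g)) (sum-fibre≤count q g))

∉-image : ∀ {m n} (q : Fin m → Bool) (g : Fin m → Fin n) {y j} →
  image q g y ≡ false → q j ≡ true → g j ≢ y
∉-image q g {j = j} y∉ qⱼ refl =
  does-false (1 ≤? fibre q g (g j)) y∉
    (count-pos (λ l → q l ∧ does (g l ≟ g j)) (cong₂ _∧_ qⱼ (dec-true (g j ≟ g j) refl)))

adj⇒≢ : ∀ {k} (H : Graph k) {i j} → adj H i j ≡ true → i ≢ j
adj⇒≢ H {i} i~j refl = contradiction (trans (≡.sym i~j) (irrefl H i)) λ ()

module Greedy {n m : ℕ} (G : Graph n) (A : Subset n) (u : Fin m → Fin n)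
              (W : Fin m → Subset n) (H : Graph m) (s : ℕ) where

  record Fits (i : Fin m) (x : Fin n) : Set where
    field
      edge    : adj G (u i) x ≡ true
      inA     : x ∈ A
      ∉W      : x ∉ W i
      avoidsH : ∀ l → adj H i l ≡ true → x ≢ u l

  SameEdge : Fin m → Fin n → Fin m → Fin n → Set
  SameEdge i x j y = (u i ≡ u j × x ≡ y) ⊎ (u i ≡ y × x ≡ u j)

  record Apart (i : Fin m) (x : Fin n) (j : Fin m) (y : Fin n) : Set where
    field
      apartH       : adj H i j ≡ true → x ≢ y
      distinctEdge : ¬ SameEdge i x j y

  apart-sym : ∀ {i x j y} → Apart i x j y → Apart j y i x
  apart-sym {i} {j = j} a = record
    { apartH       = λ hji y≡x → apartH (trans (Graph.sym H i j) hji) (≡.sym y≡x)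
    ; distinctEdge = λ { (inj₁ (p , q)) → distinctEdge (inj₁ (≡.sym p , ≡.sym q))
                       ; (inj₂ (p , q)) → distinctEdge (inj₂ (≡.sym q , ≡.sym p)) }
    }
    where open Apart a

  -- A partial assignment: v j is only meaningful where P j ≡ true.
  record Valid (P : Fin m → Bool) (v : Fin m → Fin n) : Set where
    field
      fits  : ∀ j → P j ≡ true → Fits j (v j)
      apart : ∀ j l → P j ≡ true → P l ≡ true → j ≢ l → Apart j (v j) l (v l)
      loads : ∀ y → fibre P v y ≤ s

  valid-⊆ : ∀ {P Q v} → (∀ j → Q j ≡ true → P j ≡ true) → Valid P v → Valid Q v
  valid-⊆ Q⊆P valid = record
    { fits  = λ j → fits j ∘ Q⊆P j
    ; apart = λ j l j∈Q l∈Q → apart j l (Q⊆P j j∈Q) (Q⊆P l l∈Q)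
    ; loads = λ y → ≤-trans
        (count-mono (λ j h → cong₂ _∧_ (Q⊆P j (∧-conicalˡ _ _ h)) (∧-conicalʳ _ _ h))) (loads y)
    }
    where open Valid valid

  record Admissible (P : Fin m → Bool) (v : Fin m → Fin n) (i : Fin m) (x : Fin n) : Set where
    field
      fits  : Fits i x
      apart : ∀ l → P l ≡ true → Apart i x l (v l)
      spare : fibre P v x < s

  extend : ∀ {P P′ v i x} → Valid P v → P i ≡ false → Admissible P v i x →
           (∀ j → P′ j ≡ true → P j ≡ true ⊎ j ≡ i) → Valid P′ (updateAt v i (const x))
  extend {P} {P′} {v} {i} {x} valid i∉P adm P′⊆P∪i = record { fits = fits′ ; apart = apart′ ; loads = loads′ }
    where
    module V = Valid valid
    module X = Admissible adm
    v′ = updateAt v i (const x)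

    data Origin (j : Fin m) : Set where
      old : P j ≡ true → v′ j ≡ v j → Origin j
      new : j ≡ i → v′ j ≡ x → Origin j

    origin : ∀ j → P′ j ≡ true → Origin j
    origin j j∈P′ with P′⊆P∪i j j∈P′
    ... | inj₁ j∈P = old j∈P (updateAt-minimal j i v λ { refl → contradiction (trans (≡.sym j∈P) i∉P) λ () })
    ... | inj₂ refl = new refl (updateAt-updates i v)

    fits′ : ∀ j → P′ j ≡ true → Fits j (v′ j)
    fits′ j j∈P′ with origin j j∈P′
    ... | old j∈P  v′j≡vj rewrite v′j≡vj = V.fits j j∈P
    ... | new refl v′j≡x  rewrite v′j≡x  = X.fits

    apart′ : ∀ j l → P′ j ≡ true → P′ l ≡ true → j ≢ l → Apart j (v′ j) l (v′ l)
    apart′ j l j∈P′ l∈P′ j≢l with origin j j∈P′ | origin l l∈P′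
    ... | old j∈P ej | old l∈P el rewrite ej | el = V.apart j l j∈P l∈P j≢l
    ... | new refl ej | old l∈P el rewrite ej | el = X.apart l l∈P
    ... | old j∈P ej | new refl el rewrite ej | el = apart-sym (X.apart j j∈P)
    ... | new refl _ | new refl _ = contradiction refl j≢l

    lands : ∀ {j y} → (P′ j ∧ does (v′ j ≟ y)) ≡ true → v′ j ≡ y
    lands {j} {y} h = does-true (v′ j ≟ y) (∧-conicalʳ _ _ h)

    loads′ : ∀ y → fibre P′ v′ y ≤ s
    loads′ y with x ≟ y
    ... | yes refl = begin
      fibre P′ v′ x                               ≤⟨ count-⊎ old-or-new ⟩
      fibre P v x + count (λ j → does (j ≟ i))    ≤⟨ +-monoʳ-≤ (fibre P v x) only-i ⟩
      fibre P v x + 1                             ≡⟨ +-comm (fibre P v x) 1 ⟩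
      suc (fibre P v x)                           ≤⟨ X.spare ⟩
      s                                           ∎
      where
      open ≤-Reasoning
      only-i : count (λ j → does (j ≟ i)) ≤ 1
      only-i = count-≤1 _ λ j l j≡i l≡i → trans (does-true (j ≟ i) j≡i) (≡.sym (does-true (l ≟ i) l≡i))
      old-or-new : ∀ j → (P′ j ∧ does (v′ j ≟ x)) ≡ true → (P j ∧ does (v j ≟ x)) ≡ true ⊎ does (j ≟ i) ≡ true
      old-or-new j h with origin j (∧-conicalˡ _ _ h)
      ... | old j∈P e = inj₁ (cong₂ _∧_ j∈P (dec-true (v j ≟ x) (trans (≡.sym e) (lands h))))
      ... | new j≡i _ = inj₂ (dec-true (j ≟ i) j≡i)
    ... | no x≢y = ≤-trans (count-mono still-old) (V.loads y)
      where
      still-old : ∀ j → (P′ j ∧ does (v′ j ≟ y)) ≡ true → (P j ∧ does (v j ≟ y)) ≡ true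
      still-old j h with origin j (∧-conicalˡ _ _ h)
      ... | old j∈P e = cong₂ _∧_ j∈P (dec-true (v j ≟ y) (trans (≡.sym e) (lands h)))
      ... | new _ e   = contradiction (trans (≡.sym e) (lands h)) x≢y

  module _ (Δ : ℕ)
    (degree       : ∀ i → s * (∣ W i ∣ + 3 * Δ + s) + m ≤ s * degIn G A (u i))
    (multiplicity : ∀ x → count (λ i → does (u i ≟ x)) ≤ Δ)
    (maxDegree    : maxDeg≤ H Δ) where

    candidate : Fin m → Fin n → Bool
    candidate i x = adj G (u i) x ∧ does (x ∈? A)

    module Obstacles (P : Fin m → Bool) (v : Fin m → Fin n) (i : Fin m) where

      inW headOfNbrEdge tailOfNbrEdge parallel reversed overloaded blocked : Fin n → Bool
      inW           x = does (x ∈? W i)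
      tailOfNbrEdge   = image (adj H i) u
      headOfNbrEdge   = image (λ l → P l ∧ adj H i l) v
      parallel        = image (λ l → P l ∧ does (u l ≟ u i)) v
      reversed        = image (λ l → P l ∧ does (v l ≟ u i)) u
      overloaded    x = does (s ≤? fibre P v x)
      blocked       x = inW x ∨ tailOfNbrEdge x ∨ headOfNbrEdge x ∨ parallel x ∨ reversed x ∨ overloaded x

    open Obstacles

    count-blocked : ∀ {P v} i → Valid P v →
      count (blocked P v i) ≤ ∣ W i ∣ + 3 * Δ + s + count (overloaded P v i)
    count-blocked {P} {v} i valid = ≤-trans
      (count-∨-≤ (inW P v i) _ (≤-reflexive (count-∈ (W i)))
        (count-∨-≤ (tailOfNbrEdge P v i) _ (≤-trans (count-image≤count _ u) (maxDegree i))
          (count-∨-≤ (headOfNbrEdge P v i) _ (≤-trans (count-image≤count _ v) (count-∧-≤ (maxDegree i)))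
            (count-∨-≤ (parallel P v i) _ (≤-trans (count-image≤count _ v) (count-∧-≤ (multiplicity (u i))))
              (count-∨-≤ (reversed P v i) _ (≤-trans (count-image≤count _ u) (Valid.loads valid (u i)))
                ≤-refl)))))
      (≤-reflexive (regroup (∣ W i ∣) Δ s (count (overloaded P v i))))
      where
      count-∧-≤ : ∀ {q : Fin m → Bool} {a} → count q ≤ a → count (λ l → P l ∧ q l) ≤ a
      count-∧-≤ {q} = ≤-trans (count-mono {p = λ l → P l ∧ q l} λ l → ∧-conicalʳ _ _)
      regroup : ∀ w d t f → w + (d + (d + (d + (t + f)))) ≡ w + 3 * d + t + f
      regroup = solve-∀

    count-blocked<degree : ∀ {P v i} → Valid P v → P i ≡ false → count (blocked P v i) < degIn G A (u i)
    count-blocked<degree {P} {v} {i} valid i∉P = *-cancelˡ-< s _ _ (begin-strict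
      s * count (blocked P v i)            ≤⟨ *-monoʳ-≤ s (count-blocked i valid) ⟩
      s * (B + count (overloaded P v i))   ≡⟨ *-distribˡ-+ s B _ ⟩
      s * B + s * count (overloaded P v i) ≤⟨ +-monoʳ-≤ (s * B) (markov s (fibre P v)) ⟩
      s * B + sum (fibre P v)              ≤⟨ +-monoʳ-≤ (s * B) (sum-fibre≤count P v) ⟩
      s * B + count P                      <⟨ +-monoʳ-< (s * B) (count<n P i∉P) ⟩
      s * B + m                            ≤⟨ degree i ⟩
      s * degIn G A (u i)                  ∎)
      where
      open ≤-Reasoning
      B = ∣ W i ∣ + 3 * Δ + s

    unblocked-admissible : ∀ {P v i x} → candidate i x ≡ true → blocked P v i x ≡ false → Admissible P v i x
    unblocked-admissible {P} {v} {i} {x} cand free =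
      let x∉W    , free₁   = ∨-false (inW P v i x) free
          x∉tail , free₂   = ∨-false (tailOfNbrEdge P v i x) free₁
          x∉head , free₃   = ∨-false (headOfNbrEdge P v i x) free₂
          x∉same , free₄   = ∨-false (parallel P v i x) free₃
          x∉rev  , x-spare = ∨-false (reversed P v i x) free₄
      in record
      { fits  = record
        { edge    = ∧-conicalˡ _ _ cand
        ; inA     = does-true (x ∈? A) (∧-conicalʳ _ _ cand)
        ; ∉W      = does-false (x ∈? W i) x∉W
        ; avoidsH = λ l h x≡ul → ∉-image (adj H i) u x∉tail h (≡.sym x≡ul)
        }
      ; apart = λ l l∈P → record
        { apartH       = λ h x≡vl →
            ∉-image (λ l → P l ∧ adj H i l) v x∉head (cong₂ _∧_ l∈P h) (≡.sym x≡vl)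
        ; distinctEdge = λ
          { (inj₁ (ui≡ul , x≡vl)) → ∉-image (λ l → P l ∧ does (u l ≟ u i)) v x∉same
              (cong₂ _∧_ l∈P (dec-true (u l ≟ u i) (≡.sym ui≡ul))) (≡.sym x≡vl)
          ; (inj₂ (ui≡vl , x≡ul)) → ∉-image (λ l → P l ∧ does (v l ≟ u i)) u x∉rev
              (cong₂ _∧_ l∈P (dec-true (v l ≟ u i) (≡.sym ui≡vl))) (≡.sym x≡ul)
          }
        }
      ; spare = ≰⇒> (does-false (s ≤? fibre P v x) x-spare)
      }

    admissible : ∀ {P v i} → Valid P v → P i ≡ false → Σ (Fin n) (Admissible P v i)
    admissible {P} {v} {i} valid i∉P =
      let x , cand , free = count-<-witness (candidate i) (blocked P v i) (count-blocked<degree valid i∉P)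
      in x , unblocked-admissible cand free

    below : ℕ → Fin m → Bool
    below k j = does (toℕ j <? k)

    below-suc : ∀ {k} (k<m : k < m) j → below (suc k) j ≡ true → below k j ≡ true ⊎ j ≡ fromℕ< k<m
    below-suc {k} k<m j j<1+k with m≤n⇒m<n∨m≡n (≤-pred (does-true (toℕ j <? suc k) j<1+k))
    ... | inj₁ j<k = inj₁ (dec-true (toℕ j <? k) j<k)
    ... | inj₂ j≡k = inj₂ (toℕ-injective (trans j≡k (≡.sym (toℕ-fromℕ< k<m))))

    valid-below : ∀ k → k ≤ m → Σ (Fin m → Fin n) (Valid (below k))
    valid-below zero    _   = u , record
      { fits  = λ _ ()
      ; apart = λ _ _ ()
      ; loads = λ y → ≤-trans (≤-reflexive (count-false (λ j → below 0 j ∧ does (u j ≟ y)) λ _ → refl)) z≤n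
      }
    valid-below (suc k) k<m =
      let v , valid = valid-below k (<⇒≤ k<m)
          i∉P       = dec-false (toℕ (fromℕ< k<m) <? k) (<-irrefl (toℕ-fromℕ< k<m))
          x , adm   = admissible valid i∉P
      in updateAt v (fromℕ< k<m) (const x) , extend valid i∉P adm (below-suc k<m)

    greedy : Σ (Fin m → Fin n) (Valid (λ _ → true))
    greedy = let v , valid = valid-below m ≤-refl
             in v , valid-⊆ (λ j _ → dec-true (toℕ j <? m) (toℕ<n j)) valid

proposition3p21 :
  (Δ m s : ℕ) → 1 ≤ s →
  {n : ℕ} (G : Graph n) (A : Subset n) (u : Fin m → Fin n) (W : Fin m → Subset n) (H : Graph m) →
  (∀ i → s * (∣ W i ∣ + 3 * Δ + s) + m ≤ s * degIn G A (u i)) →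
  (∀ x → count (λ i → does (u i ≟ x)) ≤ Δ) →
  maxDeg≤ H Δ →
  Σ (Fin m → Fin n) λ v →
    (∀ i → adj G (u i) (v i) ≡ true) ×
    (∀ i j → i ≢ j → ¬ ((u i ≡ u j × v i ≡ v j) ⊎ (u i ≡ v j × v i ≡ u j))) ×
    (∀ x → count (λ i → does (v i ≟ x)) ≤ s) ×
    (∀ i → v i ∈ A × v i ∉ W i) ×
    (∀ i j → adj H i j ≡ true → v i ≢ u j × v i ≢ v j)
proposition3p21 Δ m s _ G A u W H degree multiplicity maxDegree =
  let v , valid = greedy Δ degree multiplicity maxDegree
      open Valid valid
  in v
   , (λ i → Fits.edge (fits i refl))
   , (λ i j i≢j → Apart.distinctEdge (apart i j refl refl i≢j))
   , loads
   , (λ i → Fits.inA (fits i refl) , Fits.∉W (fits i refl))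
   , λ i j i~j → Fits.avoidsH (fits i refl) j i~j
               , Apart.apartH (apart i j refl refl (adj⇒≢ H i~j)) i~j
  where open Greedy G A u W H s
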